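{- Let $n\ge 2$ be an integer. Let $T_n$ be the $(n^2-1)\times n$ matrix obtained as follows: form the $(n^2-1)\times(n+1)$ matrix whose rows consist of $n-1$ copies of each of the $n+1$ cyclic permutations of the sequence $1,2,\dotsc,n+1$ (so the first $n-1$ rows are $1,2,\dotsc,n+1$, the next $n-1$ rows are $2,3,\dotsc,n+1,1$, and so on), and then delete its last column. Then there do not exist $n$ rows of $T_n$ such that the entries of these $n$ rows (viewed as an $n\times n$ matrix) are the union of $n$ pairwise disjoint transversals, where a transversal of a matrix with $n$ columns is a set of $n$ positions, one in each column and no two in the same row, whose entries are pairwise distinct. -}

module Defs where

open import Data.Nat using (ℕ; zero; suc; _+_; _*_; _∸_; _/_; _%_)
open import Data.Fin using (Fin; toℕ)
open import Data.Product using (∃; _×_)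
open import Relation.Binary.PropositionalEquality using (_≡_; _≢_)
open import Function.Definitions using (Injective)

-- Row r lies in block k = r / (n ∸ 1) (the k-th cyclic shift, 0-based, k ≤ n);
-- its entry in column j is ((k + j) mod (n+1)) + 1, i.e. the k-th cyclic
-- permutation of 1,2,…,n+1 with its last entry (column n) deleted.
T : (n : ℕ) → Fin (n * n ∸ 1) → Fin n → ℕ
T zero () j
T (suc zero) () j
T (suc (suc m)) r j = suc (((toℕ r / suc m) + toℕ j) % suc (suc (suc m)))

-- A transversal of an n×n matrix M (rows Fin n, columns Fin n), given as the
-- map t sending each column j to the row t j of the chosen position (j-th column):
-- no two positions in the same row, and pairwise distinct entries.
IsTransversal : {A : Set} (n : ℕ) → (Fin n → Fin n → A) → (Fin n → Fin n) → Set
IsTransversal n M t = Injective _≡_ _≡_ t × Injective _≡_ _≡_ (λ j → M (t j) j)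

IsUnionOfDisjointTransversals : {A : Set} (n : ℕ) → (Fin n → Fin n → A) → Set
IsUnionOfDisjointTransversals n M =
  ∃ λ (t : Fin n → Fin n → Fin n) →
    ((k : Fin n) → IsTransversal n M (t k))
    × ((k k' : Fin n) → k ≢ k' → (j : Fin n) → t k j ≢ t k' j)
    × ((i j : Fin n) → ∃ λ k → t k j ≡ i)

-- Read the entries modulo n + 1, so that row i is the sequence s i + j (j < n)
-- for a shift s i. In a transversal the n entries are distinct residues, hence
-- they miss exactly one residue u, and summing gives u + Σ s + Σ j ≡ Σ_{v ≤ n} v
-- (mod n + 1): all transversals miss the same residue u. As the transversals
-- cover the n rows, no row contains u among its n entries; a row is n consecutive
-- residues, so u is the residue in the deleted last column, s i + n. Hence all n
-- chosen rows have the same shift, i.e. lie in one block of n - 1 equal rows,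
-- which is impossible.
module Submission where

open import Defs
open import Data.Nat using (ℕ; _≤_; _*_; _∸_)
open import Data.Fin using (Fin)
open import Data.Product using (∃; _×_)
open import Relation.Binary.PropositionalEquality using (_≡_)
open import Relation.Nullary using (¬_)
open import Function.Definitions using (Injective)

open import Relation.Nullary using (contradiction)
open import Data.Nat using (zero; suc; _+_; _<_; _%_; _/_; s≤s; s≤s⁻¹; NonZero)
open import Data.Nat.Properties
  using (+-comm; +-assoc; *-comm; +-0-commutativeMonoid; n<1+n; m≤n⇒m<n∨m≡n; m+[n∸m]≡n; <⇒≤)
open import Data.Nat.DivMod
  using (%-distribˡ-+; m%n%n≡m%n; [m+n]%n≡m%n; [m+kn]%n≡m%n; m%n<n; m<n⇒m%n≡m; m≡m%n+[m/n]*n; m<n*o⇒m/o<n)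
open import Data.Nat.Solver using (module +-*-Solver)
open import Data.Fin using (zero; suc; toℕ; fromℕ<; punchIn; punchOut)
open import Data.Fin.Properties
  using (toℕ-fromℕ<; toℕ-injective; toℕ<n; punchIn-injective; punchOut-injective; punchIn-punchOut; punchInᵢ≢i; pigeonhole; <⇒≢; suc-injective)
open import Data.Vec.Functional using (removeAt)
open import Data.Product using (_,_; proj₁; proj₂)
open import Data.Sum using (inj₁; inj₂)
open import Function using (_∘_)
open import Relation.Binary.PropositionalEquality using (refl; sym; trans; cong; cong₂; subst; _≢_; module ≡-Reasoning)
open import Algebra.Properties.CommutativeMonoid.Sum +-0-commutativeMonoid
  using (sum; sum-remove; sum-cong-≗; ∑-distrib-+)

open ≡-Reasoning

module _ {m n} (f : Fin (suc m) → Fin (suc n)) (f-injective : Injective _≡_ _≡_ f) where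

  private
    head≢tail : ∀ i → f zero ≢ f (suc i)
    head≢tail i e with f-injective e
    ... | ()

  punchOutTail : Fin m → Fin n
  punchOutTail i = punchOut (head≢tail i)

  punchOutTail-injective : Injective _≡_ _≡_ punchOutTail
  punchOutTail-injective {i} {j} e =
    suc-injective (f-injective (punchOut-injective (head≢tail i) (head≢tail j) e))

  punchIn-punchOutTail : ∀ i → punchIn (f zero) (punchOutTail i) ≡ f (suc i)
  punchIn-punchOutTail i = punchIn-punchOut (head≢tail i)

  sum-∘-punchOutTail : ∀ g → sum (g ∘ f) ≡ g (f zero) + sum (removeAt g (f zero) ∘ punchOutTail)
  sum-∘-punchOutTail g =
    cong (g (f zero) +_) (sum-cong-≗ (λ i → cong g (sym (punchIn-punchOutTail i))))

sum-∘-injective : ∀ {n} (f : Fin n → Fin n) → Injective _≡_ _≡_ f →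
                  ∀ g → sum (g ∘ f) ≡ sum g
sum-∘-injective {zero}  f f-injective g = refl
sum-∘-injective {suc n} f f-injective g = begin
  sum (g ∘ f)                                                            ≡⟨ sum-∘-punchOutTail f f-injective g ⟩
  g (f zero) + sum (removeAt g (f zero) ∘ punchOutTail f f-injective)    ≡⟨ cong (g (f zero) +_) (sum-∘-injective _ (punchOutTail-injective f f-injective) _) ⟩
  g (f zero) + sum (removeAt g (f zero))                                 ≡⟨ sum-remove g ⟨
  sum g                                                                  ∎

missing-value : ∀ {n} (f : Fin n → Fin (suc n)) → Injective _≡_ _≡_ f →
                ∃ λ u → (∀ i → f i ≢ u) × (∀ g → sum (g ∘ f) + g u ≡ sum g)
missing-value {zero}  f f-injective = zero , (λ ()) , λ g → +-comm 0 (g zero)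
missing-value {suc n} f f-injective = punchIn (f zero) u , misses , sum-with-missing
  where
  f⁻ = punchOutTail f f-injective
  rec = missing-value f⁻ (punchOutTail-injective f f-injective)
  u = proj₁ rec

  misses : ∀ i → f i ≢ punchIn (f zero) u
  misses zero    e = punchInᵢ≢i (f zero) u (sym e)
  misses (suc i) e = proj₁ (proj₂ rec) i
    (punchIn-injective (f zero) _ _ (trans (punchIn-punchOutTail f f-injective i) e))

  sum-with-missing : ∀ g → sum (g ∘ f) + g (punchIn (f zero) u) ≡ sum g
  sum-with-missing g = begin
    sum (g ∘ f) + g (punchIn (f zero) u)                                   ≡⟨ cong (_+ g⁻ u) (sum-∘-punchOutTail f f-injective g) ⟩
    g (f zero) + sum (g⁻ ∘ f⁻) + g⁻ u                                      ≡⟨ +-assoc (g (f zero)) _ _ ⟩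
    g (f zero) + (sum (g⁻ ∘ f⁻) + g⁻ u)                                    ≡⟨ cong (g (f zero) +_) (proj₂ (proj₂ rec) g⁻) ⟩
    g (f zero) + sum g⁻                                                    ≡⟨ sum-remove g ⟨
    sum g                                                                  ∎
    where g⁻ = removeAt g (f zero)

module _ (n : ℕ) where

  %-cong-+ : ∀ x y z w → x % suc n ≡ y % suc n → z % suc n ≡ w % suc n →
             (x + z) % suc n ≡ (y + w) % suc n
  %-cong-+ x y z w x≡y z≡w = begin
    (x + z) % suc n                       ≡⟨ %-distribˡ-+ x z (suc n) ⟩
    (x % suc n + z % suc n) % suc n       ≡⟨ cong₂ (λ a b → (a + b) % suc n) x≡y z≡w ⟩
    (y % suc n + w % suc n) % suc n       ≡⟨ %-distribˡ-+ y w (suc n) ⟨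
    (y + w) % suc n                       ∎

  %-cancel-+ʳ : ∀ x y z → (x + z) % suc n ≡ (y + z) % suc n → x % suc n ≡ y % suc n
  %-cancel-+ʳ x y z e = begin
    x % suc n                             ≡⟨ [m+kn]%n≡m%n x z (suc n) ⟨
    (x + z * suc n) % suc n               ≡⟨ cong (λ w → (x + w) % suc n) (*-comm z (suc n)) ⟩
    (x + (z + n * z)) % suc n             ≡⟨ cong (_% suc n) (+-assoc x z (n * z)) ⟨
    ((x + z) + n * z) % suc n             ≡⟨ %-cong-+ (x + z) (y + z) (n * z) (n * z) e refl ⟩
    ((y + z) + n * z) % suc n             ≡⟨ cong (_% suc n) (+-assoc y z (n * z)) ⟩
    (y + (z + n * z)) % suc n             ≡⟨ cong (λ w → (y + w) % suc n) (*-comm z (suc n)) ⟨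
    (y + z * suc n) % suc n               ≡⟨ [m+kn]%n≡m%n y z (suc n) ⟩
    y % suc n                             ∎

  sum-% : ∀ {k} (h : Fin k → ℕ) → sum (λ j → h j % suc n) % suc n ≡ sum h % suc n
  sum-% {zero}  h = refl
  sum-% {suc k} h = %-cong-+ (h zero % suc n) (h zero) (sum (λ j → h (suc j) % suc n)) (sum (h ∘ suc))
    (m%n%n≡m%n (h zero) (suc n)) (sum-% (h ∘ suc))

  +-%-surjective : ∀ a {v} → v < suc n → ∃ λ j → j < suc n × (a + j) % suc n ≡ v
  +-%-surjective a {v} v<N = w % suc n , m%n<n w (suc n) , hits
    where
    r = a % suc n
    w = v + (suc n ∸ r)
    hits : (a + w % suc n) % suc n ≡ v
    hits = begin
      (a + w % suc n) % suc n                 ≡⟨ %-cong-+ a r (w % suc n) w (sym (m%n%n≡m%n a (suc n))) (m%n%n≡m%n w (suc n)) ⟩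
      (r + (v + (suc n ∸ r))) % suc n         ≡⟨ cong (_% suc n) (+-comm r _) ⟩
      ((v + (suc n ∸ r)) + r) % suc n         ≡⟨ cong (_% suc n) (+-assoc v _ r) ⟩
      (v + ((suc n ∸ r) + r)) % suc n         ≡⟨ cong (λ x → (v + x) % suc n) (trans (+-comm _ r) (m+[n∸m]≡n (<⇒≤ (m%n<n a (suc n))))) ⟩
      (v + suc n) % suc n                     ≡⟨ [m+n]%n≡m%n v (suc n) ⟩
      v % suc n                               ≡⟨ m<n⇒m%n≡m v<N ⟩
      v                                       ∎

isUnionOfDisjointTransversals-map⁻ : ∀ {A B : Set} {n} (h : A → B) (M : Fin n → Fin n → A) →
  IsUnionOfDisjointTransversals n (λ i j → h (M i j)) → IsUnionOfDisjointTransversals n M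
isUnionOfDisjointTransversals-map⁻ h M (t , transversal , disjoint , covered) =
  t , (λ c → proj₁ (transversal c) , λ e → proj₂ (transversal c) (cong h e)) , disjoint , covered

shiftMatrix : ∀ {n} → (Fin n → ℕ) → Fin n → Fin n → ℕ
shiftMatrix {n} s i j = (s i + toℕ j) % suc n

shifts-congruent : ∀ {n} (s : Fin n → ℕ) → IsUnionOfDisjointTransversals n (shiftMatrix s) →
                   ∀ i i' → s i % suc n ≡ s i' % suc n
shifts-congruent {n} s (t , transversal , _ , covered) i i' =
  %-cancel-+ʳ n (s i) (s i') n (trans (row-misses i) (trans (missing-unique i i') (sym (row-misses i'))))
  where
  N = suc n

  value : Fin n → Fin n → Fin N
  value c j = fromℕ< (m%n<n (s (t c j) + toℕ j) N)

  toℕ-value : ∀ c j → toℕ (value c j) ≡ shiftMatrix s (t c j) j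
  toℕ-value c j = toℕ-fromℕ< _

  value-injective : ∀ c → Injective _≡_ _≡_ (value c)
  value-injective c {j} {j'} e =
    proj₂ (transversal c) (trans (sym (toℕ-value c j)) (trans (cong toℕ e) (toℕ-value c j')))

  missing : Fin n → Fin N
  missing c = proj₁ (missing-value (value c) (value-injective c))

  missing-not-value : ∀ c j → value c j ≢ missing c
  missing-not-value c = proj₁ (proj₂ (missing-value (value c) (value-injective c)))

  sum-values+missing : ∀ c → sum (toℕ ∘ value c) + toℕ (missing c) ≡ sum {N} toℕ
  sum-values+missing c = proj₂ (proj₂ (missing-value (value c) (value-injective c))) toℕ

  sum-values : ∀ c → sum (toℕ ∘ value c) % N ≡ (sum s + sum {n} toℕ) % N
  sum-values c = begin
    sum (toℕ ∘ value c) % N                  ≡⟨ cong (_% N) (sum-cong-≗ (toℕ-value c)) ⟩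
    sum (λ j → (s (t c j) + toℕ j) % N) % N  ≡⟨ sum-% n (λ j → s (t c j) + toℕ j) ⟩
    sum (λ j → s (t c j) + toℕ j) % N        ≡⟨ cong (_% N) (∑-distrib-+ (s ∘ t c) toℕ) ⟩
    (sum (s ∘ t c) + sum {n} toℕ) % N        ≡⟨ cong (λ x → (x + sum {n} toℕ) % N) (sum-∘-injective (t c) (proj₁ (transversal c)) s) ⟩
    (sum s + sum {n} toℕ) % N                ∎

  missing-congruence : ∀ c → (toℕ (missing c) + (sum s + sum {n} toℕ)) % N ≡ sum {N} toℕ % N
  missing-congruence c = begin
    (toℕ (missing c) + (sum s + sum {n} toℕ)) % N  ≡⟨ %-cong-+ n (toℕ (missing c)) (toℕ (missing c)) _ _ refl (sum-values c) ⟨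
    (toℕ (missing c) + sum (toℕ ∘ value c)) % N    ≡⟨ cong (_% N) (+-comm (toℕ (missing c)) _) ⟩
    (sum (toℕ ∘ value c) + toℕ (missing c)) % N    ≡⟨ cong (_% N) (sum-values+missing c) ⟩
    sum {N} toℕ % N                                ∎

  missing-unique : ∀ c c' → toℕ (missing c) ≡ toℕ (missing c')
  missing-unique c c' = begin
    toℕ (missing c)           ≡⟨ m<n⇒m%n≡m (toℕ<n (missing c)) ⟨
    toℕ (missing c) % N       ≡⟨ %-cancel-+ʳ n (toℕ (missing c)) (toℕ (missing c')) _ (trans (missing-congruence c) (sym (missing-congruence c'))) ⟩
    toℕ (missing c') % N      ≡⟨ m<n⇒m%n≡m (toℕ<n (missing c')) ⟩
    toℕ (missing c')          ∎

  row-misses : ∀ i → (s i + n) % N ≡ toℕ (missing i)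
  row-misses i with +-%-surjective n (s i) (toℕ<n (missing i))
  ... | j , j<N , hit with m≤n⇒m<n∨m≡n (s≤s⁻¹ j<N)
  ... | inj₂ refl = hit
  ... | inj₁ j<n  = contradiction (toℕ-injective value≡missing) (missing-not-value c column)
    where
    column = fromℕ< j<n
    c = proj₁ (covered i column)
    value≡missing : toℕ (value c column) ≡ toℕ (missing c)
    value≡missing = begin
      toℕ (value c column)                    ≡⟨ toℕ-value c column ⟩
      (s (t c column) + toℕ column) % N       ≡⟨ cong₂ (λ r x → (s r + x) % N) (proj₂ (covered i column)) (toℕ-fromℕ< j<n) ⟩
      (s i + j) % N                           ≡⟨ hit ⟩
      toℕ (missing i)                         ≡⟨ missing-unique i c ⟩
      toℕ (missing c)                         ∎

%-/-injective : ∀ d .{{_ : NonZero d}} {x y} → x % d ≡ y % d → x / d ≡ y / d → x ≡ y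
%-/-injective d {x} {y} x%d≡y%d x/d≡y/d = begin
  x                   ≡⟨ m≡m%n+[m/n]*n x d ⟩
  x % d + x / d * d   ≡⟨ cong₂ (λ r q → r + q * d) x%d≡y%d x/d≡y/d ⟩
  y % d + y / d * d   ≡⟨ m≡m%n+[m/n]*n y d ⟨
  y                   ∎

quotient-pigeonhole : ∀ d .{{_ : NonZero d}} (x : Fin (suc d) → ℕ) →
                      (∀ i i' → x i / d ≡ x i' / d) → ¬ Injective _≡_ _≡_ x
quotient-pigeonhole d x same-quotient x-injective
  with i , i' , i<i' , same-remainder ← pigeonhole (n<1+n d) (λ i → fromℕ< (m%n<n (x i) d)) =
  <⇒≢ i<i' (x-injective (%-/-injective d remainders≡ (same-quotient i i')))
  where
  remainders≡ : x i % d ≡ x i' % d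
  remainders≡ = trans (sym (toℕ-fromℕ< _)) (trans (cong toℕ same-remainder) (toℕ-fromℕ< _))

rows≡ : ∀ m → suc (suc m) * suc (suc m) ∸ 1 ≡ suc (suc (suc m)) * suc m
rows≡ = solve 1 (λ m → (con 1 :+ m) :+ (con 1 :+ m) :* (con 2 :+ m) := (con 3 :+ m) :* (con 1 :+ m)) refl
  where open +-*-Solver

block<n+1 : ∀ m (r : Fin (suc (suc m) * suc (suc m) ∸ 1)) → toℕ r / suc m < suc (suc (suc m))
block<n+1 m r = m<n*o⇒m/o<n (subst (toℕ r <_) (rows≡ m) (toℕ<n r))

proposition1 : (n : ℕ) → 2 ≤ n →
    ¬ (∃ λ (ρ : Fin n → Fin (n * n ∸ 1)) →
         Injective _≡_ _≡_ ρ × IsUnionOfDisjointTransversals n (λ i j → T n (ρ i) j))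
proposition1 (suc zero) (s≤s ())
proposition1 (suc (suc m)) _ (ρ , ρ-injective , decomposition) =
  quotient-pigeonhole (suc m) (toℕ ∘ ρ) same-block (λ e → ρ-injective (toℕ-injective e))
  where
  block : Fin (suc (suc m)) → ℕ
  block i = toℕ (ρ i) / suc m

  same-block : ∀ i i' → block i ≡ block i'
  same-block i i' = begin
    block i                       ≡⟨ m<n⇒m%n≡m (block<n+1 m (ρ i)) ⟨
    block i % suc (suc (suc m))   ≡⟨ shifts-congruent block shifted-decomposition i i' ⟩
    block i' % suc (suc (suc m))  ≡⟨ m<n⇒m%n≡m (block<n+1 m (ρ i')) ⟩
    block i'                      ∎
    where
    shifted-decomposition : IsUnionOfDisjointTransversals (suc (suc m)) (shiftMatrix block)
    shifted-decomposition = isUnionOfDisjointTransversals-map⁻ suc (shiftMatrix block) decomposition
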